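{- Let $k,t,p,q$ be positive integers with $k \geq 2t$, $1 \leq p \leq 2t-1$, and suppose $C_{p,q}$ is a submatrix of $A_{k,t}$. If $q \geq p-1$, then $q \leq k-2t+1$.
   Context: For positive integers $k,t$ with $k\ge t$, $A_{k,t}$ is the $0,1$-matrix of size $\binom{k}{t}\times\binom{k}{t}$ whose rows and columns are indexed by all $t$-element subsets of $[k]=\{1,\dots,k\}$, with entry $1$ in row $x$, column $y$ if and only if $x\cap y\neq\emptyset$. For integers $p\ge 1$, $q\ge 0$ and $n=p+q$, $C_{p,q}$ is the $n\times n$ circulant $0,1$-matrix whose entry in row $i$, column $j$ ($1\le i,j\le n$) is $1$ iff $(i-j) \bmod n \in\{0,1,\dots,p-1\}$ (so its first column is $p$ ones followed by $q$ zeros). An $n\times m$ $0,1$-matrix $M$ is a submatrix of $A_{k,t}$ if there are distinct $t$-subsets $F_1,\dots,F_n$ of $[k]$ and distinct $t$-subsets $G_1,\dots,G_m$ of $[k]$ with $M_{ij}=1$ iff $F_i\cap G_j\ne\emptyset$. -}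

module Defs where

open import Data.Nat using (ℕ; suc; _+_; _∸_; _<_; _≡ᵇ_)
open import Data.Nat.DivMod using (_%_)
open import Data.Fin using (Fin; toℕ)
open import Data.Fin.Subset using (Subset; _∩_; ∣_∣; Nonempty)
open import Data.Product using (Σ; _×_)
open import Relation.Binary.PropositionalEquality using (_≡_)
open import Function.Definitions using (Injective)
open import Function.Bundles using (_⇔_)

IsTSubset : (k t : ℕ) → Subset k → Set
IsTSubset k t S = ∣ S ∣ ≡ t

diffMod : (n : ℕ) → Fin n → Fin n → ℕ
diffMod (suc n') i j = (toℕ i + suc n' ∸ toℕ j) % suc n'

-- Entry (i,j) of the circulant C_{p,q}, n = p + q: 1 iff (i - j) mod n ∈ {0,…,p-1}.
-- (0-indexed rows/columns; shifting both indices by 1 does not change i - j.)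
CEntry : (p q : ℕ) → Fin (p + q) → Fin (p + q) → Set
CEntry p q i j = diffMod (p + q) i j < p

IsSubmatrixA : (k t n m : ℕ) → (Fin n → Fin m → Set) → Set
IsSubmatrixA k t n m M =
  Σ (Fin n → Subset k) λ F →
  Σ (Fin m → Subset k) λ G →
    (∀ i → IsTSubset k t (F i)) ×
    (∀ j → IsTSubset k t (G j)) ×
    Injective _≡_ _≡_ F ×
    Injective _≡_ _≡_ G ×
    (∀ i j → M i j ⇔ Nonempty (F i ∩ G j))

-- Suppose C_{p,q} (p, q ≥ 1, n = p + q) is realised inside A_{k,t} by
-- t-subsets F_0 … F_{n-1} (rows) and G_0 … G_{n-1} (columns), so that
-- F_a ∩ G_b ≠ ∅ iff (a - b) mod n < p.  Write p = 1 + p', q = 1 + q'.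
-- Reading off three families of entries of C_{p,q}:
--   * F_{j+p} meets G_{j+1}             (difference p - 1),
--   * F_{j+p} misses G_{i+1} for i < j  (difference j - i + p - 1 ≥ p),
--   * F_0 misses G_{j+1}                (difference n - j - 1 ≥ p),
-- for all i, j ≤ q'.  This is a "staircase" pattern, and the general
-- staircase lemma shows that F_0, G_1 and one point y_j ∈ F_{j+p} ∩ G_{j+1}
-- for each 1 ≤ j ≤ q' are pairwise disjoint pieces of [k].  Hence
-- 2t + q - 1 ≤ k, which is the theorem.
module Submission where

open import Defs
open import Data.Nat using (ℕ; _+_; _∸_; _≤_; _*_)
open import Data.Nat.Base using (suc; _<_; z≤n; s≤s)
open import Data.Nat.Properties
open import Data.Nat.DivMod using (_%_; _mod_; [m+n]%n≡m%n; m<n⇒m%n≡m; m%n<n)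
open import Data.Fin.Base using (Fin; toℕ)
import Data.Fin.Base as Fin
open import Data.Fin.Properties using (toℕ<n; toℕ-fromℕ<)
open import Data.Fin.Subset using (Subset; _∩_; _∪_; ∣_∣; Nonempty; Empty; _∈_; _∉_; ⁅_⁆; inside; outside)
open import Data.Fin.Subset.Properties
  using (x∈p∩q⁺; x∈p∩q⁻; x∈p∪q⁻; x∈⁅y⁆⇒x≡y; ∣⁅x⁆∣≡1; ∣p∣≤n; drop-∷-Empty)
open import Data.Vec.Base using (_∷_; []; here)
open import Data.Product using (Σ; _×_; _,_)
open import Data.Sum using (inj₁; inj₂)
open import Data.Empty using (⊥)
open import Relation.Nullary using (contradiction)
open import Relation.Binary.PropositionalEquality
open import Function.Bundles using (_⇔_; Equivalence)

∣∪∣-disjoint : ∀ {n} (a b : Subset n) → Empty (a ∩ b) → ∣ a ∪ b ∣ ≡ ∣ a ∣ + ∣ b ∣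
∣∪∣-disjoint []            []            _ = refl
∣∪∣-disjoint (inside ∷ a)  (inside ∷ b)  e = contradiction (Fin.zero , here) e
∣∪∣-disjoint (inside ∷ a)  (outside ∷ b) e = cong suc (∣∪∣-disjoint a b (drop-∷-Empty e))
∣∪∣-disjoint (outside ∷ a) (outside ∷ b) e = ∣∪∣-disjoint a b (drop-∷-Empty e)
∣∪∣-disjoint (outside ∷ a) (inside ∷ b)  e =
  trans (cong suc (∣∪∣-disjoint a b (drop-∷-Empty e))) (sym (+-suc ∣ a ∣ ∣ b ∣))

∣∪⁅x⁆∣-fresh : ∀ {n} (s : Subset n) {x : Fin n} → x ∉ s → ∣ s ∪ ⁅ x ⁆ ∣ ≡ suc ∣ s ∣
∣∪⁅x⁆∣-fresh s {x} x∉s = begin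
  ∣ s ∪ ⁅ x ⁆ ∣      ≡⟨ ∣∪∣-disjoint s ⁅ x ⁆ disjoint ⟩
  ∣ s ∣ + ∣ ⁅ x ⁆ ∣  ≡⟨ cong (∣ s ∣ +_) (∣⁅x⁆∣≡1 x) ⟩
  ∣ s ∣ + 1          ≡⟨ +-comm ∣ s ∣ 1 ⟩
  suc ∣ s ∣          ∎
  where
  open ≡-Reasoning
  disjoint : Empty (s ∩ ⁅ x ⁆)
  disjoint (y , y∈s∩x) with x∈p∩q⁻ s ⁅ x ⁆ y∈s∩x
  ... | y∈s , y∈⁅x⁆ = x∉s (subst (_∈ s) (x∈⁅y⁆⇒x≡y x y∈⁅x⁆) y∈s)

-- Picking y_j ∈ R_j ∩ C_j, the sets A, C_0 and the points y_1 … y_m are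
-- pairwise disjoint, so |A| + |C_0| + m ≤ k.
module Staircase {k : ℕ} (A : Subset k) (R C : ℕ → Subset k) (m : ℕ)
  (corner   : ∀ j → j ≤ m → Empty (A ∩ C j))
  (above    : ∀ i j → i < j → j ≤ m → Empty (R j ∩ C i))
  (diagonal : ∀ j → j ≤ m → Nonempty (R j ∩ C j)) where

  -- S contains no point of the diagonal cells R_j ∩ C_j with c < j ≤ m;
  -- this is what keeps the points chosen later outside S.
  AvoidsBeyond : Subset k → ℕ → Set
  AvoidsBeyond S c = ∀ {x} j → c < j → j ≤ m → x ∈ S → x ∈ R j → x ∈ C j → ⊥

  -- Stage c of the construction: a set of size |A| + |C_0| + c (namely
  -- A ∪ C_0 ∪ {y_1 … y_c}) avoiding the diagonal cells beyond c.
  stage : ∀ c → c ≤ m → Σ (Subset k) λ S → ∣ S ∣ ≡ ∣ A ∣ + ∣ C 0 ∣ + c × AvoidsBeyond S c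
  stage 0 _ = A ∪ C 0 , size , avoids
    where
    size : ∣ A ∪ C 0 ∣ ≡ ∣ A ∣ + ∣ C 0 ∣ + 0
    size = trans (∣∪∣-disjoint A (C 0) (corner 0 z≤n)) (sym (+-identityʳ _))
    avoids : AvoidsBeyond (A ∪ C 0) 0
    avoids j 0<j j≤m x∈A∪C₀ x∈Rj x∈Cj with x∈p∪q⁻ A (C 0) x∈A∪C₀
    ... | inj₁ x∈A  = corner j j≤m (_ , x∈p∩q⁺ (x∈A , x∈Cj))
    ... | inj₂ x∈C₀ = above 0 j 0<j j≤m (_ , x∈p∩q⁺ (x∈Rj , x∈C₀))
  stage (suc c) c<m with stage c (<⇒≤ c<m) | diagonal (suc c) c<m
  ... | S , ∣S∣ , avoidsS | y , y∈R∩C with x∈p∩q⁻ (R (suc c)) (C (suc c)) y∈R∩C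
  ...   | y∈R , y∈C = S ∪ ⁅ y ⁆ , size , avoids
    where
    y∉S : y ∉ S
    y∉S y∈S = avoidsS (suc c) ≤-refl c<m y∈S y∈R y∈C
    size : ∣ S ∪ ⁅ y ⁆ ∣ ≡ ∣ A ∣ + ∣ C 0 ∣ + suc c
    size = trans (∣∪⁅x⁆∣-fresh S y∉S)
                 (trans (cong suc ∣S∣) (sym (+-suc (∣ A ∣ + ∣ C 0 ∣) c)))
    avoids : AvoidsBeyond (S ∪ ⁅ y ⁆) (suc c)
    avoids j c<j j≤m x∈S∪y x∈Rj x∈Cj with x∈p∪q⁻ S ⁅ y ⁆ x∈S∪y
    ... | inj₁ x∈S = avoidsS j (<-trans (n<1+n c) c<j) j≤m x∈S x∈Rj x∈Cj
    ... | inj₂ x∈y = above (suc c) j c<j j≤m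
                         (_ , x∈p∩q⁺ (x∈Rj , subst (_∈ C (suc c)) (sym (x∈⁅y⁆⇒x≡y y x∈y)) y∈C))

  staircase-bound : ∣ A ∣ + ∣ C 0 ∣ + m ≤ k
  staircase-bound with stage m ≤-refl
  ... | S , ∣S∣ , _ = subst (_≤ k) ∣S∣ (∣p∣≤n S)

diffMod-≥ : ∀ {n} (i j : Fin n) → toℕ j ≤ toℕ i → diffMod n i j ≡ toℕ i ∸ toℕ j
diffMod-≥ {suc n} i j j≤i = begin
  (toℕ i + suc n ∸ toℕ j) % suc n  ≡⟨ cong (_% suc n) (+-∸-comm (suc n) j≤i) ⟩
  (toℕ i ∸ toℕ j + suc n) % suc n  ≡⟨ [m+n]%n≡m%n (toℕ i ∸ toℕ j) (suc n) ⟩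
  (toℕ i ∸ toℕ j) % suc n          ≡⟨ m<n⇒m%n≡m (≤-<-trans (m∸n≤m (toℕ i) (toℕ j)) (toℕ<n i)) ⟩
  toℕ i ∸ toℕ j                    ∎
  where open ≡-Reasoning

diffMod-< : ∀ {n} (i j : Fin n) → toℕ i < toℕ j → diffMod n i j ≡ toℕ i + n ∸ toℕ j
diffMod-< {suc n} i j i<j = m<n⇒m%n≡m (+-cancelʳ-< (toℕ j) _ _ wrapped)
  where
  open ≤-Reasoning
  j≤i+n : toℕ j ≤ toℕ i + suc n
  j≤i+n = ≤-trans (<⇒≤ (toℕ<n j)) (m≤n+m (suc n) (toℕ i))
  wrapped : toℕ i + suc n ∸ toℕ j + toℕ j < suc n + toℕ j
  wrapped = begin-strict
    toℕ i + suc n ∸ toℕ j + toℕ j  ≡⟨ m∸n+n≡m j≤i+n ⟩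
    toℕ i + suc n                  <⟨ +-monoˡ-< (suc n) i<j ⟩
    toℕ j + suc n                  ≡⟨ +-comm (toℕ j) (suc n) ⟩
    suc n + toℕ j                  ∎

module CirculantStaircase {k p' q' : ℕ} (F G : Fin (suc p' + suc q') → Subset k)
  (realises : ∀ i j → CEntry (suc p') (suc q') i j ⇔ Nonempty (F i ∩ G j)) where

  n : ℕ
  n = suc p' + suc q'

  ix : ℕ → Fin n
  ix a = a mod n

  toℕ-ix : ∀ {a} → a < n → toℕ (ix a) ≡ a
  toℕ-ix {a} a<n = trans (toℕ-fromℕ< (m%n<n a n)) (m<n⇒m%n≡m a<n)

  diff-≥ : ∀ {a b} → b ≤ a → a < n → diffMod n (ix a) (ix b) ≡ a ∸ b
  diff-≥ {a} {b} b≤a a<n =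
    trans (diffMod-≥ (ix a) (ix b) (subst₂ _≤_ (sym (toℕ-ix b<n)) (sym (toℕ-ix a<n)) b≤a))
          (cong₂ _∸_ (toℕ-ix a<n) (toℕ-ix b<n))
    where b<n = ≤-<-trans b≤a a<n

  diff-< : ∀ {a b} → a < b → b < n → diffMod n (ix a) (ix b) ≡ a + n ∸ b
  diff-< {a} {b} a<b b<n =
    trans (diffMod-< (ix a) (ix b) (subst₂ _<_ (sym (toℕ-ix a<n)) (sym (toℕ-ix b<n)) a<b))
          (cong₂ (λ x y → x + n ∸ y) (toℕ-ix a<n) (toℕ-ix b<n))
    where a<n = <-trans a<b b<n

  meets : ∀ i j → diffMod n i j < suc p' → Nonempty (F i ∩ G j)
  meets i j = Equivalence.to (realises i j)

  misses : ∀ i j → suc p' ≤ diffMod n i j → Empty (F i ∩ G j)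
  misses i j p≤d meet = ≤⇒≯ p≤d (Equivalence.from (realises i j) meet)

  row col : ℕ → Fin n
  row j = ix (suc j + p')
  col j = ix (suc j)

  row-bound : ∀ {j} → j ≤ q' → suc j + p' < n
  row-bound {j} j≤q' = s≤s (subst (_≤ p' + suc q') (+-comm p' (suc j)) (+-monoʳ-≤ p' (s≤s j≤q')))

  -- F_{j+p} meets G_{j+1}: their difference is p - 1.
  diagonal : ∀ j → j ≤ q' → Nonempty (F (row j) ∩ G (col j))
  diagonal j j≤q' = meets (row j) (col j) (subst (_< suc p') (sym difference) (n<1+n p'))
    where
    difference : diffMod n (row j) (col j) ≡ p'
    difference = trans (diff-≥ (m≤m+n (suc j) p') (row-bound j≤q')) (m+n∸m≡n (suc j) p')

  -- F_{j+p} misses G_{i+1} for i < j: their difference is (j - i) + p - 1 ≥ p.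
  above : ∀ i j → i < j → j ≤ q' → Empty (F (row j) ∩ G (col i))
  above i j i<j j≤q' = misses (row j) (col i) (subst (suc p' ≤_) (sym difference) (+-monoˡ-≤ p' (m<n⇒0<n∸m i<j)))
    where
    difference : diffMod n (row j) (col i) ≡ (j ∸ i) + p'
    difference = trans (diff-≥ (s≤s (≤-trans (<⇒≤ i<j) (m≤m+n j p'))) (row-bound j≤q'))
                       (+-∸-comm p' (<⇒≤ i<j))

  -- F_0 misses G_{j+1}: their difference wraps around to n - j - 1 ≥ p.
  corner : ∀ j → j ≤ q' → Empty (F (ix 0) ∩ G (col j))
  corner j j≤q' = misses (ix 0) (col j) (subst (suc p' ≤_) (sym difference) (m≤m+n (suc p') (suc q' ∸ suc j)))
    where
    difference : diffMod n (ix 0) (col j) ≡ suc p' + (suc q' ∸ suc j)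
    difference = trans (diff-< (s≤s z≤n) (≤-<-trans (m≤m+n (suc j) p') (row-bound j≤q')))
                       (+-∸-assoc (suc p') (s≤s j≤q'))

  circulant-bound : ∣ F (ix 0) ∣ + ∣ G (col 0) ∣ + q' ≤ k
  circulant-bound = Staircase.staircase-bound (F (ix 0)) (λ j → F (row j)) (λ j → G (col j)) q'
    corner above diagonal

theorem2 : (k t p q : ℕ) → 1 ≤ t → 1 ≤ p → 1 ≤ q →
    2 * t ≤ k → p ≤ 2 * t ∸ 1 →
    IsSubmatrixA k t (p + q) (p + q) (CEntry p q) →
    p ∸ 1 ≤ q → q + 2 * t ≤ k + 1
theorem2 k t (suc p') (suc q') _ _ _ _ _ (F , G , ∣F∣≡t , ∣G∣≡t , _ , _ , realises) _ = begin
  suc q' + 2 * t                              ≡⟨ cong (λ s → suc (q' + (t + s))) (+-identityʳ t) ⟩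
  suc (q' + (t + t))                          ≡⟨ cong suc (+-comm q' (t + t)) ⟩
  suc (t + t + q')                            ≡⟨ cong (λ s → suc (s + q')) (sym (cong₂ _+_ (∣F∣≡t _) (∣G∣≡t _))) ⟩
  suc (∣ F (ix 0) ∣ + ∣ G (col 0) ∣ + q')     ≤⟨ s≤s circulant-bound ⟩
  suc k                                       ≡⟨ +-comm 1 k ⟩
  k + 1                                       ∎
  where
  open ≤-Reasoning
  open CirculantStaircase F G realises
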